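{- Let $2\le k\le n-2$ and $r=n-k$. Then every subset of $[n]$ of cardinality at most $r-2$ is a face of $\Delta_k(P_n^2)$ (i.e., $\Delta_k(P_n^2)$ contains the full $(r-3)$-skeleton of the simplex on $[n]$). A subset of $[n]$ of cardinality $r-1$ is a nonface if and only if it is the complement of an interval $\{s,s+1,\dots,s+k\}$ of length $k+1$, and a subset of cardinality $r$ is a nonface if and only if it is the complement of a $k$-subset $C$ with $P_n^2[C]$ connected.
   Context: For a finite simple graph $G$ on $[n]=\{1,\dots,n\}$ and $2\le k\le n$, the $k$-cut complex $\Delta_k(G)$ is the simplicial complex on $[n]$ whose facets are the sets $[n]\setminus T$, where $T$ ranges over the $k$-element subsets of $[n]$ with $G[T]$ disconnected. The squared path $P_n^2$ is the graph on $[n]$ whose edges are the pairs $\{i,i+1\}$ ($1\le i\le n-1$) and $\{i,i+2\}$ ($1\le i\le n-2$). -}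

module Defs where

open import Data.Nat using (ℕ; _+_; _≤_; _<_)
open import Data.Fin using (Fin; toℕ)
open import Data.Fin.Subset using (Subset; _∈_; ∣_∣; _∩_) renaming (⊥ to ∅)
open import Data.Bool using (_∧_)
open import Data.Nat using (_≤ᵇ_)
open import Data.Vec using (tabulate)
open import Data.Product using (Σ; _×_)
open import Data.Sum using (_⊎_)
open import Relation.Binary.PropositionalEquality using (_≡_)
open import Relation.Nullary using (¬_)

-- Vertex i : Fin n stands for the vertex (toℕ i + 1) of [n].
-- A graph on [n] is given by its (symmetric, irreflexive) adjacency relation.
Graph : ℕ → Set₁
Graph n = Fin n → Fin n → Set

P² : (n : ℕ) → Graph n
P² n i j = (toℕ j ≡ toℕ i + 1 ⊎ toℕ j ≡ toℕ i + 2)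
         ⊎ (toℕ i ≡ toℕ j + 1 ⊎ toℕ i ≡ toℕ j + 2)

data Reach {n : ℕ} (G : Graph n) (T : Subset n) : Fin n → Fin n → Set where
  here : ∀ {u} → Reach G T u u
  step : ∀ {u v w} → G u v → v ∈ T → Reach G T v w → Reach G T u w

Connected : {n : ℕ} → Graph n → Subset n → Set
Connected G T = ∀ u v → u ∈ T → v ∈ T → Reach G T u v

-- σ is a face of the k-cut complex Δ_k(G): σ ⊆ [n] ∖ T for some
-- k-subset T with G[T] disconnected (i.e. σ ∩ T = ∅).
IsFace : {n : ℕ} → Graph n → ℕ → Subset n → Set
IsFace {n} G k σ =
  Σ (Subset n) λ T → (∣ T ∣ ≡ k) × (¬ Connected G T) × (σ ∩ T ≡ ∅)

-- The interval {s+1, ..., s+1+len} of [n] (0-indexed: {s, ..., s+len}).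
Interval : (n : ℕ) → ℕ → ℕ → Subset n
Interval n s len = tabulate λ i → (s ≤ᵇ toℕ i) ∧ (toℕ i ≤ᵇ s + len)

-- For P², an induced subgraph P²[T] is connected exactly when T has no gap: two
-- consecutive vacant positions with members of T on both sides (edges join vertices at
-- distance at most 2, so no walk jumps a gap, and without gaps one walks rightwards).  If |∁σ| ≥ k+2, take T to be
-- the least member a of ∁σ together with k-1 members beyond a+2.  If |∁σ| = k, T must be
-- ∁σ itself.  If |∁σ| = k+1, σ is a nonface iff no deletion ∁σ - z has a gap; a vacancy
-- right after a non-maximal member would produce such a deletion, so ∁σ is an interval,
-- and conversely a k-subset of an interval misses only one point, hence has no gap.

module Submission where

open import Defs
open import Data.Bool.Properties using (T-≡; T-∧)
open import Data.Empty using (⊥-elim)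
open import Data.Fin as Fin using (Fin; toℕ; fromℕ<)
open import Data.Fin.Properties using (toℕ-injective; toℕ-fromℕ<; toℕ<n; any?)
open import Data.Fin.Subset
  using (Subset; inside; outside; _∈_; _∉_; _⊆_; ∁; _∩_; _─_; _-_; ⁅_⁆; ∣_∣; Nonempty)
  renaming (⊥ to ∅)
open import Data.Fin.Subset.Properties
  using ( _∈?_; nonempty?; Empty-unique; ∣⊥∣≡0; ∣⁅x⁆∣≡1; ∉⊥; x∉⁅y⁆⇒x≢y
        ; ⊆-refl; ⊆-antisym; drop-∷-⊆; s⊆s; out⊆; p⊆q⇒∣p∣≤∣q∣; p⊂q⇒∣p∣<∣q∣
        ; x∈p⇒x∉∁p; x∈∁p⇒x∉p; x∉∁p⇒x∈p; x∉p⇒x∈∁p; ∣∁p∣≡n∸∣p∣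
        ; x∈⁅x⁆; x∈⁅y⁆⇒x≡y; x∈p∩q⁺; x∈p∩q⁻; x∈p∧x∉q⇒x∈p─q; p─q⊆p; x∈p∧x≢y⇒x∈p-y; x∈p⇒∣p-x∣<∣p∣ )
open import Data.Nat using (ℕ; zero; suc; _+_; _∸_; _≤_; _<_; z≤n; s≤s; s≤s⁻¹)
open import Data.Nat.Properties
open import Data.Product using (Σ; ∃; _×_; _,_; proj₁; proj₂)
open import Data.Sum using (inj₁; inj₂)
open import Data.Vec using ([]; _∷_; here; there)
open import Data.Vec.Properties using ([]=⇒lookup; lookup⇒[]=; lookup∘tabulate)
open import Function using (_∘_)
open import Function.Bundles using (_⇔_; mk⇔; Equivalence)
open import Relation.Binary.Definitions using (Symmetric)
open import Relation.Binary.PropositionalEquality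
open import Relation.Nullary using (¬_; Dec; yes; no; Stable; contradiction)
open import Relation.Nullary.Decidable using (_×-dec_)

private
  variable
    n k : ℕ
    σ : Subset n

m<o∧o≢1+m∧o≢2+m⇒2+m<o : {m o : ℕ} → m < o → o ≢ 1 + m → o ≢ 2 + m → 2 + m < o
m<o∧o≢1+m∧o≢2+m⇒2+m<o m<o o≢1+m o≢2+m = ≤∧≢⇒< (≤∧≢⇒< m<o (≢-sym o≢1+m)) (≢-sym o≢2+m)

∁-involutive : (p : Subset n) → ∁ (∁ p) ≡ p
∁-involutive p =
  ⊆-antisym (λ x∈∁∁p → x∉∁p⇒x∈p (x∈∁p⇒x∉p x∈∁∁p)) (λ x∈p → x∉p⇒x∈∁p (x∈p⇒x∉∁p x∈p))

∣p∣≡n∸m⇒∣∁p∣≡m : (p : Subset n) {m : ℕ} → m ≤ n → ∣ p ∣ ≡ n ∸ m → ∣ ∁ p ∣ ≡ m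
∣p∣≡n∸m⇒∣∁p∣≡m {n} p m≤n ∣p∣≡n∸m =
  trans (∣∁p∣≡n∸∣p∣ p) (trans (cong (n ∸_) ∣p∣≡n∸m) (m∸[m∸n]≡n m≤n))

∣p∣≤n∸m⇒m≤∣∁p∣ : (p : Subset n) {m : ℕ} → m ≤ n → ∣ p ∣ ≤ n ∸ m → m ≤ ∣ ∁ p ∣
∣p∣≤n∸m⇒m≤∣∁p∣ {n} p {m} m≤n ∣p∣≤n∸m =
  subst (_≤ ∣ ∁ p ∣) (m∸[m∸n]≡n m≤n)
    (subst (n ∸ (n ∸ m) ≤_) (sym (∣∁p∣≡n∸∣p∣ p)) (∸-monoʳ-≤ n ∣p∣≤n∸m))

x∈p─q⇒x∉q : {p q : Subset n} {x : Fin n} → x ∈ p ─ q → x ∉ q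
x∈p─q⇒x∉q {p = inside ∷ p} {outside ∷ q} here ()
x∈p─q⇒x∉q {p = _ ∷ p} {_ ∷ q} (there x∈p─q) (there x∈q) = x∈p─q⇒x∉q x∈p─q x∈q

x∈p-y⁻ : {p : Subset n} {x y : Fin n} → x ∈ p - y → x ∈ p × x ≢ y
x∈p-y⁻ {p = p} {y = y} x∈p-y = p─q⊆p p ⁅ y ⁆ x∈p-y , x∉⁅y⁆⇒x≢y (x∈p─q⇒x∉q x∈p-y)

∣p∣≤∣p─q∣+∣q∣ : (p q : Subset n) → ∣ p ∣ ≤ ∣ p ─ q ∣ + ∣ q ∣
∣p∣≤∣p─q∣+∣q∣ []            []            = z≤n
∣p∣≤∣p─q∣+∣q∣ (outside ∷ p) (outside ∷ q) = ∣p∣≤∣p─q∣+∣q∣ p q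
∣p∣≤∣p─q∣+∣q∣ (inside  ∷ p) (outside ∷ q) = s≤s (∣p∣≤∣p─q∣+∣q∣ p q)
∣p∣≤∣p─q∣+∣q∣ (outside ∷ p) (inside  ∷ q) =
  subst (∣ p ∣ ≤_) (sym (+-suc _ _)) (m≤n⇒m≤1+n (∣p∣≤∣p─q∣+∣q∣ p q))
∣p∣≤∣p─q∣+∣q∣ (inside  ∷ p) (inside  ∷ q) =
  subst (suc ∣ p ∣ ≤_) (sym (+-suc _ _)) (s≤s (∣p∣≤∣p─q∣+∣q∣ p q))

∣p∣≤1+∣p-x∣ : (p : Subset n) (x : Fin n) → ∣ p ∣ ≤ suc ∣ p - x ∣
∣p∣≤1+∣p-x∣ p x =
  subst (∣ p ∣ ≤_) (trans (cong (∣ p - x ∣ +_) (∣⁅x⁆∣≡1 x)) (+-comm _ 1)) (∣p∣≤∣p─q∣+∣q∣ p ⁅ x ⁆)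

x∈p⇒∣p∣≡1+∣p-x∣ : {p : Subset n} {x : Fin n} → x ∈ p → ∣ p ∣ ≡ suc ∣ p - x ∣
x∈p⇒∣p∣≡1+∣p-x∣ {p = p} {x} x∈p = ≤-antisym (∣p∣≤1+∣p-x∣ p x) (x∈p⇒∣p-x∣<∣p∣ x∈p)

p⊆q∧∣q∣≤∣p∣⇒p≡q : {p q : Subset n} → p ⊆ q → ∣ q ∣ ≤ ∣ p ∣ → p ≡ q
p⊆q∧∣q∣≤∣p∣⇒p≡q {p = p} p⊆q ∣q∣≤∣p∣ = ⊆-antisym p⊆q q⊆p
  where
  q⊆p : _ ⊆ p
  q⊆p {x} x∈q with x ∈? p
  ... | yes x∈p = x∈p
  ... | no  x∉p = contradiction ∣q∣≤∣p∣ (<⇒≱ (p⊂q⇒∣p∣<∣q∣ (p⊆q , x , x∈q , x∉p)))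

0<∣p∣⇒Nonempty : (p : Subset n) → 0 < ∣ p ∣ → Nonempty p
0<∣p∣⇒Nonempty {n} p 0<∣p∣ with nonempty? p
... | yes p-nonempty = p-nonempty
... | no  p-empty    = contradiction (trans (cong ∣_∣ (Empty-unique p-empty)) (∣⊥∣≡0 n)) (>⇒≢ 0<∣p∣)

∃-other : (p : Subset n) → 1 < ∣ p ∣ → (x : Fin n) → ∃ λ z → z ∈ p × z ≢ x
∃-other p 1<∣p∣ x =
  let z , z∈p-x = 0<∣p∣⇒Nonempty (p - x) (s≤s⁻¹ (≤-trans 1<∣p∣ (∣p∣≤1+∣p-x∣ p x)))
  in  z , x∈p-y⁻ z∈p-x

∃-third : (p : Subset n) → 2 < ∣ p ∣ → (x y : Fin n) → ∃ λ z → z ∈ p × z ≢ x × z ≢ y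
∃-third p 2<∣p∣ x y =
  let z , z∈p-x , z≢y = ∃-other (p - x) (s≤s⁻¹ (≤-trans 2<∣p∣ (∣p∣≤1+∣p-x∣ p x))) y
      z∈p , z≢x       = x∈p-y⁻ z∈p-x
  in  z , z∈p , z≢x , z≢y

⊆-sandwich : {r p : Subset n} {j : ℕ} → r ⊆ p → ∣ r ∣ ≤ j → j ≤ ∣ p ∣ →
             ∃ λ q → r ⊆ q × q ⊆ p × ∣ q ∣ ≡ j
⊆-sandwich {r = []} {[]} _ _ j≤0 = [] , ⊆-refl , ⊆-refl , sym (n≤0⇒n≡0 j≤0)
⊆-sandwich {r = inside ∷ r} {outside ∷ p} r⊆p _ _ = contradiction (r⊆p here) λ ()
⊆-sandwich {r = inside ∷ r} {inside ∷ p} {suc j} r⊆p (s≤s r≤j) (s≤s j≤p) =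
  let q , r⊆q , q⊆p , ∣q∣≡j = ⊆-sandwich (drop-∷-⊆ r⊆p) r≤j j≤p
  in  inside ∷ q , s⊆s r⊆q , s⊆s q⊆p , cong suc ∣q∣≡j
⊆-sandwich {r = outside ∷ r} {outside ∷ p} r⊆p r≤j j≤p =
  let q , r⊆q , q⊆p , ∣q∣≡j = ⊆-sandwich (drop-∷-⊆ r⊆p) r≤j j≤p
  in  outside ∷ q , s⊆s r⊆q , s⊆s q⊆p , ∣q∣≡j
⊆-sandwich {r = outside ∷ r} {inside ∷ p} {j} r⊆p r≤j j≤1+p with j ≤? ∣ p ∣
... | yes j≤p =
  let q , r⊆q , q⊆p , ∣q∣≡j = ⊆-sandwich (drop-∷-⊆ r⊆p) r≤j j≤p
  in  outside ∷ q , s⊆s r⊆q , out⊆ q⊆p , ∣q∣≡j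
... | no  j≰p = inside ∷ p , out⊆ (drop-∷-⊆ r⊆p) , ⊆-refl , ≤-antisym (≰⇒> j≰p) j≤1+p

minimum : {p : Subset n} → Nonempty p → ∃ λ a → a ∈ p × (∀ {x} → x ∈ p → toℕ a ≤ toℕ x)
minimum {p = inside ∷ p} _ = Fin.zero , here , λ _ → z≤n
minimum {p = outside ∷ p} (Fin.suc x , there x∈p) =
  let a , a∈p , a-least = minimum (x , x∈p)
  in  Fin.suc a , there a∈p , λ { (there y∈p) → s≤s (a-least y∈p) }

infix 4 _∈ᴺ_ _∉ᴺ_ _∈ᴺ?_

_∈ᴺ_ : ℕ → Subset n → Set
z ∈ᴺ p = ∃ λ i → i ∈ p × toℕ i ≡ z

_∉ᴺ_ : ℕ → Subset n → Set
z ∉ᴺ p = ¬ z ∈ᴺ p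

_∈ᴺ?_ : (z : ℕ) (p : Subset n) → Dec (z ∈ᴺ p)
z ∈ᴺ? p = any? λ i → i ∈? p ×-dec toℕ i ≟ z

∉ᴺ-antimono : {p q : Subset n} {z : ℕ} → p ⊆ q → z ∉ᴺ q → z ∉ᴺ p
∉ᴺ-antimono p⊆q z∉q (i , i∈p , i≡z) = z∉q (i , p⊆q i∈p , i≡z)

∉ᴺ-p-x : {p : Subset n} {x : Fin n} {z : ℕ} → z ∉ᴺ p → z ∉ᴺ p - x
∉ᴺ-p-x {p = p} {x} = ∉ᴺ-antimono (p─q⊆p p ⁅ x ⁆)

toℕx∉ᴺp-x : {p : Subset n} {x : Fin n} {z : ℕ} → toℕ x ≡ z → z ∉ᴺ p - x
toℕx∉ᴺp-x x≡z (i , i∈p-x , i≡z) = proj₂ (x∈p-y⁻ i∈p-x) (toℕ-injective (trans i≡z (sym x≡z)))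

∉ᴺ⇒toℕ≢ : {p : Subset n} {i : Fin n} {z : ℕ} → i ∈ p → z ∉ᴺ p → toℕ i ≢ z
∉ᴺ⇒toℕ≢ i∈p z∉p i≡z = z∉p (_ , i∈p , i≡z)

∉ᴺ⇒≢ : {p : Subset n} {i j : Fin n} {z : ℕ} → i ∈ p → z ∉ᴺ p → toℕ j ≡ z → i ≢ j
∉ᴺ⇒≢ i∈p z∉p j≡z refl = z∉p (_ , i∈p , j≡z)

∈-Interval⁺ : {s len : ℕ} {i : Fin n} → s ≤ toℕ i → toℕ i ≤ s + len → i ∈ Interval n s len
∈-Interval⁺ {i = i} s≤i i≤s+len =
  lookup⇒[]= i _ (trans (lookup∘tabulate _ i)
    (Equivalence.to T-≡ (Equivalence.from T-∧ (≤⇒≤ᵇ s≤i , ≤⇒≤ᵇ i≤s+len))))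

∈-Interval⁻ : {s len : ℕ} {i : Fin n} → i ∈ Interval n s len → s ≤ toℕ i × toℕ i ≤ s + len
∈-Interval⁻ {s = s} {len} {i} i∈I =
  let s≤ᵇi , i≤ᵇs+len = Equivalence.to T-∧
        (Equivalence.from T-≡ (trans (sym (lookup∘tabulate _ i)) ([]=⇒lookup i∈I)))
  in  ≤ᵇ⇒≤ s (toℕ i) s≤ᵇi , ≤ᵇ⇒≤ (toℕ i) (s + len) i≤ᵇs+len

∈ᴺ-Interval : {s len z : ℕ} → s ≤ z → z ≤ s + len → z < n → z ∈ᴺ Interval n s len
∈ᴺ-Interval {n} {s} {len} s≤z z≤s+len z<n =
  fromℕ< z<n , ∈-Interval⁺ (subst (s ≤_) (sym z≡) s≤z) (subst (_≤ s + len) (sym z≡) z≤s+len) , z≡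
  where z≡ = toℕ-fromℕ< z<n

∣p∣≤width : (s w : ℕ) (p : Subset n) → (∀ {i} → i ∈ p → s ≤ toℕ i × toℕ i < s + w) → ∣ p ∣ ≤ w
∣p∣≤width {n} s zero p in-window = ≤-reflexive (trans (cong ∣_∣ (Empty-unique empty)) (∣⊥∣≡0 n))
  where
  empty : ¬ Nonempty p
  empty (i , i∈p) =
    let s≤i , i<s+0 = in-window i∈p in <⇒≱ i<s+0 (subst (_≤ toℕ i) (sym (+-identityʳ s)) s≤i)
∣p∣≤width s (suc w) p in-window = narrow (s + w ∈ᴺ? p)
  where
  below : ∀ {i} → i ∈ p → toℕ i ≢ s + w → s ≤ toℕ i × toℕ i < s + w
  below {i} i∈p i≢s+w =
    let s≤i , i<s+1+w = in-window i∈p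
    in  s≤i , ≤∧≢⇒< (s≤s⁻¹ (subst (toℕ i <_) (+-suc s w) i<s+1+w)) i≢s+w
  narrow : Dec (s + w ∈ᴺ p) → ∣ p ∣ ≤ suc w
  narrow (yes (x , x∈p , x≡s+w)) =
    ≤-trans (∣p∣≤1+∣p-x∣ p x) (s≤s (∣p∣≤width s w (p - x) λ i∈p-x →
      let i∈p , i≢x = x∈p-y⁻ i∈p-x
      in  below i∈p (λ i≡s+w → i≢x (toℕ-injective (trans i≡s+w (sym x≡s+w))))))
  narrow (no s+w∉p) =
    m≤n⇒m≤1+n (∣p∣≤width s w p λ i∈p → below i∈p λ i≡s+w → s+w∉p (_ , i∈p , i≡s+w))

width≤∣p∣ : (s w : ℕ) (p : Subset n) → s + w ≤ n →
            (∀ {i} → s ≤ toℕ i → toℕ i < s + w → i ∈ p) → w ≤ ∣ p ∣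
width≤∣p∣ s zero    p _        _       = z≤n
width≤∣p∣ {n} s (suc w) p s+1+w≤n covered =
  ≤-trans (s≤s (width≤∣p∣ s w (p - x) (<⇒≤ s+w<n) covered′)) (x∈p⇒∣p-x∣<∣p∣ x∈p)
  where
  s+w<n = subst (_≤ n) (+-suc s w) s+1+w≤n
  x = fromℕ< s+w<n
  x≡s+w = toℕ-fromℕ< s+w<n
  s+w<s+1+w = +-monoʳ-< s (n<1+n w)
  x∈p = covered (subst (s ≤_) (sym x≡s+w) (m≤m+n s w)) (subst (_< s + suc w) (sym x≡s+w) s+w<s+1+w)
  covered′ : ∀ {i} → s ≤ toℕ i → toℕ i < s + w → i ∈ p - x
  covered′ s≤i i<s+w =
    x∈p∧x≢y⇒x∈p-y (covered s≤i (<-trans i<s+w s+w<s+1+w)) λ { refl → <-irrefl x≡s+w i<s+w }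

∣Interval∣≤ : (s len : ℕ) → ∣ Interval n s len ∣ ≤ suc len
∣Interval∣≤ {n} s len = ∣p∣≤width s (suc len) (Interval n s len) λ {i} i∈I →
  let s≤i , i≤s+len = ∈-Interval⁻ i∈I in s≤i , subst (toℕ i <_) (sym (+-suc s len)) (s≤s i≤s+len)

1+len≤∣Interval∣ : {s len : ℕ} → s + len < n → suc len ≤ ∣ Interval n s len ∣
1+len≤∣Interval∣ {n} {s} {len} s+len<n =
  width≤∣p∣ s (suc len) (Interval n s len) (subst (_≤ n) (sym (+-suc s len)) s+len<n)
    λ {i} s≤i i<s+1+len →
      ∈-Interval⁺ s≤i (s≤s⁻¹ (subst (toℕ i <_) (+-suc s len) i<s+1+len))

Reach-snoc : {G : Graph n} {T : Subset n} {u v w : Fin n} →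
             Reach G T u v → G v w → w ∈ T → Reach G T u w
Reach-snoc here               v~w w∈T = step v~w w∈T here
Reach-snoc (step u~x x∈T x⇝v) v~w w∈T = step u~x x∈T (Reach-snoc x⇝v v~w w∈T)

Reach-reverse : {G : Graph n} {T : Subset n} {u w : Fin n} →
                Symmetric G → u ∈ T → Reach G T u w → Reach G T w u
Reach-reverse G-sym u∈T here               = here
Reach-reverse G-sym u∈T (step u~v v∈T v⇝w) =
  Reach-snoc (Reach-reverse G-sym v∈T v⇝w) (G-sym u~v) u∈T

P²-sym : Symmetric (P² n)
P²-sym (inj₁ v-above-u) = inj₂ v-above-u
P²-sym (inj₂ u-above-v) = inj₁ u-above-v

P²-step≤2 : {u v : Fin n} → P² n u v → toℕ v ≤ 2 + toℕ u
P²-step≤2 {u = u} (inj₁ (inj₁ v≡u+1)) = m≤n⇒m≤1+n (≤-reflexive (trans v≡u+1 (+-comm (toℕ u) 1)))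
P²-step≤2 {u = u} (inj₁ (inj₂ v≡u+2)) = ≤-reflexive (trans v≡u+2 (+-comm (toℕ u) 2))
P²-step≤2 {v = v} (inj₂ (inj₁ u≡v+1)) =
  m≤n⇒m≤o+n 2 (≤-trans (m≤m+n (toℕ v) 1) (≤-reflexive (sym u≡v+1)))
P²-step≤2 {v = v} (inj₂ (inj₂ u≡v+2)) =
  m≤n⇒m≤o+n 2 (≤-trans (m≤m+n (toℕ v) 2) (≤-reflexive (sym u≡v+2)))

P²-forward : {u v : Fin n} → toℕ u < toℕ v → toℕ v ≤ 2 + toℕ u → P² n u v
P²-forward {u = u} {v} u<v v≤2+u with toℕ v ≟ 2 + toℕ u
... | yes v≡2+u = inj₁ (inj₂ (trans v≡2+u (+-comm 2 (toℕ u))))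
... | no  v≢2+u = inj₁ (inj₁ (trans (≤-antisym (s≤s⁻¹ (≤∧≢⇒< v≤2+u v≢2+u)) u<v) (+-comm 1 (toℕ u))))

record Gap {n : ℕ} (T : Subset n) : Set where
  constructor gap
  field
    {lo hi} : Fin n
    t       : ℕ
    lo∈T    : lo ∈ T
    hi∈T    : hi ∈ T
    lo<t    : toℕ lo < t
    1+t<hi  : suc t < toℕ hi
    t∉T     : t ∉ᴺ T
    1+t∉T   : suc t ∉ᴺ T

Gap⇒¬Connected : {T : Subset n} → Gap T → ¬ Connected (P² n) T
Gap⇒¬Connected {n} {T} (gap t lo∈T hi∈T lo<t 1+t<hi t∉T 1+t∉T) connected =
  <-asym (stays-left (connected _ _ lo∈T hi∈T) lo<t) (<-trans (n<1+n t) 1+t<hi)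
  where
  lands-left : ∀ {v} → v ∈ T → toℕ v ≤ suc t → toℕ v < t
  lands-left v∈T v≤1+t =
    ≤∧≢⇒< (s≤s⁻¹ (≤∧≢⇒< v≤1+t λ v≡1+t → 1+t∉T (_ , v∈T , v≡1+t))) λ v≡t → t∉T (_ , v∈T , v≡t)
  stays-left : ∀ {u w} → Reach (P² n) T u w → toℕ u < t → toℕ w < t
  stays-left here               u<t = u<t
  stays-left (step u~v v∈T v⇝w) u<t =
    stays-left v⇝w (lands-left v∈T (≤-trans (P²-step≤2 u~v) (s≤s u<t)))

next-member : {T : Subset n} {u v : Fin n} → ¬ Gap T → u ∈ T → v ∈ T → 2 + toℕ u < toℕ v →
              ∃ λ w → w ∈ T × toℕ u < toℕ w × toℕ w ≤ 2 + toℕ u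
next-member {T = T} {u} ¬gap u∈T v∈T 2+u<v with 1 + toℕ u ∈ᴺ? T | 2 + toℕ u ∈ᴺ? T
... | yes (w , w∈T , w≡1+u) | _ =
  w , w∈T , ≤-reflexive (sym w≡1+u) , m≤n⇒m≤1+n (≤-reflexive w≡1+u)
... | no _ | yes (w , w∈T , w≡2+u) =
  w , w∈T , ≤-trans (n≤1+n _) (≤-reflexive (sym w≡2+u)) , ≤-reflexive w≡2+u
... | no 1+u∉T | no 2+u∉T = ⊥-elim (¬gap (gap (1 + toℕ u) u∈T v∈T ≤-refl 2+u<v 1+u∉T 2+u∉T))

¬Gap⇒rightwards : {T : Subset n} → ¬ Gap T → ∀ fuel {u v} → u ∈ T → v ∈ T →
                  toℕ u ≤ toℕ v → toℕ v ≤ fuel + toℕ u → Reach (P² n) T u v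
¬Gap⇒rightwards {n} {T} ¬gap zero {u} _ _ u≤v v≤u =
  subst (Reach (P² n) T u) (toℕ-injective (≤-antisym u≤v v≤u)) here
¬Gap⇒rightwards {n} {T} ¬gap (suc f) {u} {v} u∈T v∈T u≤v v≤1+f+u
  with toℕ v ≤? 2 + toℕ u | toℕ u ≟ toℕ v
... | _         | yes u≡v = subst (Reach (P² n) T u) (toℕ-injective u≡v) here
... | yes v≤2+u | no  u≢v = step (P²-forward (≤∧≢⇒< u≤v u≢v) v≤2+u) v∈T here
... | no  v≰2+u | _       =
  let w , w∈T , u<w , w≤2+u = next-member ¬gap u∈T v∈T (≰⇒> v≰2+u)
      v≤f+w = ≤-trans v≤1+f+u (≤-trans (≤-reflexive (sym (+-suc f (toℕ u)))) (+-monoʳ-≤ f u<w))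
  in  step (P²-forward u<w w≤2+u) w∈T
        (¬Gap⇒rightwards ¬gap f w∈T v∈T (≤-trans w≤2+u (<⇒≤ (≰⇒> v≰2+u))) v≤f+w)

¬Gap⇒Connected : {T : Subset n} → ¬ Gap T → Connected (P² n) T
¬Gap⇒Connected ¬gap u v u∈T v∈T with ≤-total (toℕ u) (toℕ v)
... | inj₁ u≤v = ¬Gap⇒rightwards ¬gap (toℕ v) u∈T v∈T u≤v (m≤m+n (toℕ v) (toℕ u))
... | inj₂ v≤u =
  Reach-reverse P²-sym v∈T (¬Gap⇒rightwards ¬gap (toℕ u) v∈T u∈T v≤u (m≤m+n (toℕ u) (toℕ v)))

Connected-P²-stable : {T : Subset n} → Stable (Connected (P² n) T)
Connected-P²-stable ¬¬connected = ¬Gap⇒Connected λ g → ¬¬connected (Gap⇒¬Connected g)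

⊆∁⇒disjoint : {σ T : Subset n} → T ⊆ ∁ σ → σ ∩ T ≡ ∅
⊆∁⇒disjoint {σ = σ} {T} T⊆∁σ = Empty-unique λ (x , x∈σ∩T) →
  let x∈σ , x∈T = x∈p∩q⁻ σ T x∈σ∩T in x∈∁p⇒x∉p (T⊆∁σ x∈T) x∈σ

disjoint⇒⊆∁ : {σ T : Subset n} → σ ∩ T ≡ ∅ → T ⊆ ∁ σ
disjoint⇒⊆∁ {σ = σ} σ∩T≡∅ {x} x∈T with x ∈? σ
... | yes x∈σ = contradiction (subst (x ∈_) σ∩T≡∅ (x∈p∩q⁺ (x∈σ , x∈T))) ∉⊥
... | no  x∉σ = x∉p⇒x∈∁p x∉σ

disconnected⇒face : {G : Graph n} {σ T : Subset n} →
                    T ⊆ ∁ σ → ∣ T ∣ ≡ k → ¬ Connected G T → IsFace G k σ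
disconnected⇒face T⊆∁σ ∣T∣≡k disconnected = _ , ∣T∣≡k , disconnected , ⊆∁⇒disjoint T⊆∁σ

nonface⇔connected-complement : {G : Graph n} {σ : Subset n} → (∀ {T} → Stable (Connected G T)) →
  ∣ ∁ σ ∣ ≡ k → (¬ IsFace G k σ) ⇔ (Σ (Subset n) λ C → (∣ C ∣ ≡ k) × Connected G C × (σ ≡ ∁ C))
nonface⇔connected-complement {n} {k} {G} {σ} stable ∣∁σ∣≡k = mk⇔ to from
  where
  to : ¬ IsFace G k σ → Σ (Subset n) λ C → (∣ C ∣ ≡ k) × Connected G C × (σ ≡ ∁ C)
  to nonface =
    ∁ σ , ∣∁σ∣≡k , stable (nonface ∘ disconnected⇒face ⊆-refl ∣∁σ∣≡k) , sym (∁-involutive σ)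
  from : (Σ (Subset n) λ C → (∣ C ∣ ≡ k) × Connected G C × (σ ≡ ∁ C)) → ¬ IsFace G k σ
  from (C , ∣C∣≡k , connected , σ≡∁C) (T , ∣T∣≡k , disconnected , σ∩T≡∅) =
    disconnected (subst (Connected G) (sym T≡C) connected)
    where
    ∁σ≡C = trans (cong ∁ σ≡∁C) (∁-involutive C)
    T≡C = p⊆q∧∣q∣≤∣p∣⇒p≡q (subst (T ⊆_) ∁σ≡C (disjoint⇒⊆∁ σ∩T≡∅))
                          (≤-reflexive (trans ∣C∣≡k (sym ∣T∣≡k)))

∃-gapped-subset : {W : Subset n} {a : Fin n} → a ∈ W → (∀ {x} → x ∈ W → x ≢ a → 2 + toℕ a < toℕ x) →
                  2 ≤ k → k ≤ ∣ W ∣ → ∃ λ T → T ⊆ W × ∣ T ∣ ≡ k × Gap T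
∃-gapped-subset {W = W} {a} a∈W far 2≤k k≤∣W∣ =
  let T , ⁅a⁆⊆T , T⊆W , ∣T∣≡k = ⊆-sandwich ⁅a⁆⊆W (≤-trans (≤-reflexive (∣⁅x⁆∣≡1 a)) (<⇒≤ 2≤k)) k≤∣W∣
      y , y∈T , y≢a = ∃-other T (subst (1 <_) (sym ∣T∣≡k) 2≤k) a
  in  T , T⊆W , ∣T∣≡k ,
      gap (suc (toℕ a)) (⁅a⁆⊆T (x∈⁅x⁆ a)) y∈T ≤-refl (far (T⊆W y∈T) y≢a)
          (∉ᴺ-antimono T⊆W (vacant ≤-refl (n≤1+n _))) (∉ᴺ-antimono T⊆W (vacant (n≤1+n _) ≤-refl))
  where
  ⁅a⁆⊆W : ⁅ a ⁆ ⊆ W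
  ⁅a⁆⊆W x∈⁅a⁆ = subst (_∈ W) (sym (x∈⁅y⁆⇒x≡y a x∈⁅a⁆)) a∈W
  vacant : ∀ {z} → toℕ a < z → z ≤ 2 + toℕ a → z ∉ᴺ W
  vacant a<z z≤2+a (i , i∈W , i≡z) =
    <⇒≱ (far i∈W λ { refl → <-irrefl i≡z a<z }) (subst (_≤ 2 + toℕ a) (sym i≡z) z≤2+a)

small⇒face : 2 ≤ k → k + 2 ≤ ∣ ∁ σ ∣ → IsFace (P² n) k σ
small⇒face {k = k} {n = n} {σ = σ} 2≤k k+2≤∣∁σ∣ =
  let a , a∈∁σ , a-least =
        minimum (0<∣p∣⇒Nonempty (∁ σ) (≤-trans (s≤s z≤n) (≤-trans (m≤n+m 2 k) k+2≤∣∁σ∣)))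
      T , T⊆W , ∣T∣≡k , T-gap = ∃-gapped-subset (a∈W a∈∁σ) (far a-least) 2≤k (k≤∣W∣ a)
  in  disconnected⇒face (p─q⊆p (∁ σ) _ ∘ T⊆W) ∣T∣≡k (Gap⇒¬Connected T-gap)
  where
  W : Fin n → Subset n
  W a = ∁ σ ─ Interval n (suc (toℕ a)) 1
  a∈W : ∀ {a} → a ∈ ∁ σ → a ∈ W a
  a∈W a∈∁σ = x∈p∧x∉q⇒x∈p─q a∈∁σ λ a∈J → 1+n≰n (proj₁ (∈-Interval⁻ a∈J))
  far : ∀ {a} → (∀ {x} → x ∈ ∁ σ → toℕ a ≤ toℕ x) → ∀ {x} → x ∈ W a → x ≢ a → 2 + toℕ a < toℕ x
  far {a} a-least {x} x∈W x≢a =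
    let a<x = ≤∧≢⇒< (a-least (p─q⊆p (∁ σ) _ x∈W)) λ a≡x → x≢a (toℕ-injective (sym a≡x))
    in  subst (_< toℕ x) (+-comm (suc (toℕ a)) 1)
          (≰⇒> λ x≤a+2 → x∈p─q⇒x∉q x∈W (∈-Interval⁺ a<x x≤a+2))
  k≤∣W∣ : ∀ a → k ≤ ∣ W a ∣
  k≤∣W∣ a = +-cancelʳ-≤ 2 k ∣ W a ∣ (begin
    k + 2                                    ≤⟨ k+2≤∣∁σ∣ ⟩
    ∣ ∁ σ ∣                                  ≤⟨ ∣p∣≤∣p─q∣+∣q∣ (∁ σ) _ ⟩
    ∣ W a ∣ + ∣ Interval n (suc (toℕ a)) 1 ∣  ≤⟨ +-monoʳ-≤ ∣ W a ∣ (∣Interval∣≤ {n} (suc (toℕ a)) 1) ⟩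
    ∣ W a ∣ + 2                              ∎)
    where open ≤-Reasoning

Gap⊆Interval⇒∣T∣<len : {T : Subset n} {s len : ℕ} → Gap T → T ⊆ Interval n s len → ∣ T ∣ < len
Gap⊆Interval⇒∣T∣<len {n} {T} {s} {len} (gap t lo∈T hi∈T lo<t 1+t<hi t∉T 1+t∉T) T⊆I =
  let x , x∈I , x≡t   = ∈ᴺ-Interval s≤t (≤-trans (<⇒≤ t<hi) hi≤s+len) t<n
      y , y∈I , y≡1+t = ∈ᴺ-Interval (m≤n⇒m≤1+n s≤t) (≤-trans (<⇒≤ 1+t<hi) hi≤s+len) 1+t<n
      y∈I-x = x∈p∧x≢y⇒x∈p-y y∈I λ y≡x →
        <-irrefl (trans (sym x≡t) (trans (cong toℕ (sym y≡x)) y≡1+t)) (n<1+n t)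
      T⊆I-x-y : T ⊆ I - x - y
      T⊆I-x-y i∈T =
        x∈p∧x≢y⇒x∈p-y (x∈p∧x≢y⇒x∈p-y (T⊆I i∈T) (∉ᴺ⇒≢ i∈T t∉T x≡t)) (∉ᴺ⇒≢ i∈T 1+t∉T y≡1+t)
  in  s≤s⁻¹ (begin
        2 + ∣ T ∣         ≤⟨ s≤s (s≤s (p⊆q⇒∣p∣≤∣q∣ T⊆I-x-y)) ⟩
        2 + ∣ I - x - y ∣ ≡⟨ cong suc (x∈p⇒∣p∣≡1+∣p-x∣ y∈I-x) ⟨
        1 + ∣ I - x ∣     ≡⟨ x∈p⇒∣p∣≡1+∣p-x∣ x∈I ⟨
        ∣ I ∣             ≤⟨ ∣Interval∣≤ {n} s len ⟩
        1 + len           ∎)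
  where
  open ≤-Reasoning
  I = Interval n s len
  s≤t : s ≤ t
  s≤t = ≤-trans (proj₁ (∈-Interval⁻ {s = s} {len} (T⊆I lo∈T))) (<⇒≤ lo<t)
  hi≤s+len = proj₂ (∈-Interval⁻ {s = s} {len} (T⊆I hi∈T))
  t<hi = <-trans (n<1+n t) 1+t<hi
  1+t<n = <-trans 1+t<hi (toℕ<n _)
  t<n = <-trans (n<1+n t) 1+t<n

DeletionsGapFree : Subset n → Set
DeletionsGapFree U = ∀ {z} → z ∈ U → ¬ Gap (U - z)

-- A member x followed by a vacancy at x+1 but not maximal yields a gap after deleting
-- a suitable z: a third member if x+2 is vacant too, else x itself if some member lies
-- below x, else the member at x+2.
DeletionsGapFree⇒1+x∈ᴺ : {U : Subset n} → 2 < ∣ U ∣ → DeletionsGapFree U →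
                          {x y : Fin n} → x ∈ U → y ∈ U → toℕ x < toℕ y → suc (toℕ x) ∈ᴺ U
DeletionsGapFree⇒1+x∈ᴺ {U = U} 2<∣U∣ gap-free {x} {y} x∈U y∈U x<y with suc (toℕ x) ∈ᴺ? U
... | yes 1+x∈U = 1+x∈U
... | no  1+x∉U with 2 + toℕ x ∈ᴺ? U | any? (λ v → v ∈? U ×-dec toℕ v <? toℕ x)
...   | no 2+x∉U | _ =
  let z , z∈U , z≢x , z≢y = ∃-third U 2<∣U∣ x y
      2+x<y = m<o∧o≢1+m∧o≢2+m⇒2+m<o x<y (∉ᴺ⇒toℕ≢ y∈U 1+x∉U) (∉ᴺ⇒toℕ≢ y∈U 2+x∉U)
  in  ⊥-elim (gap-free z∈U
        (gap (suc (toℕ x)) (x∈p∧x≢y⇒x∈p-y x∈U (≢-sym z≢x)) (x∈p∧x≢y⇒x∈p-y y∈U (≢-sym z≢y))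
             ≤-refl 2+x<y (∉ᴺ-p-x 1+x∉U) (∉ᴺ-p-x 2+x∉U)))
...   | yes (w , w∈U , w≡2+x) | yes (v , v∈U , v<x) =
  let 1+x<w = subst (suc (toℕ x) <_) (sym w≡2+x) ≤-refl
  in  ⊥-elim (gap-free x∈U
        (gap (toℕ x) (x∈p∧x≢y⇒x∈p-y v∈U λ { refl → <-irrefl refl v<x })
             (x∈p∧x≢y⇒x∈p-y w∈U λ { refl → 1+n≰n (<⇒≤ 1+x<w) })
             v<x 1+x<w (toℕx∉ᴺp-x refl) (∉ᴺ-p-x 1+x∉U)))
...   | yes (w , w∈U , w≡2+x) | no nothing-below =
  let c , c∈U , c≢x , c≢w = ∃-third U 2<∣U∣ x w
      x<c = ≤∧≢⇒< (≮⇒≥ λ c<x → nothing-below (c , c∈U , c<x)) λ x≡c → c≢x (toℕ-injective (sym x≡c))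
      2+x<c = m<o∧o≢1+m∧o≢2+m⇒2+m<o x<c (∉ᴺ⇒toℕ≢ c∈U 1+x∉U)
                λ c≡2+x → c≢w (toℕ-injective (trans c≡2+x (sym w≡2+x)))
  in  ⊥-elim (gap-free w∈U
        (gap (suc (toℕ x)) (x∈p∧x≢y⇒x∈p-y x∈U λ { refl → m≢1+n+m (toℕ x) {1} w≡2+x })
             (x∈p∧x≢y⇒x∈p-y c∈U c≢w) ≤-refl 2+x<c (∉ᴺ-p-x 1+x∉U) (toℕx∉ᴺp-x w≡2+x)))

DeletionsGapFree⇒Interval : {U : Subset n} → 2 ≤ k → ∣ U ∣ ≡ suc k → DeletionsGapFree U →
                            Σ ℕ λ s → s + k < n × U ≡ Interval n s k
DeletionsGapFree⇒Interval {n} {k} {U} 2≤k ∣U∣≡1+k gap-free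
  with minimum (0<∣p∣⇒Nonempty U (subst (0 <_) (sym ∣U∣≡1+k) (s≤s z≤n)))
... | a , a∈U , a-least = toℕ a , a+k<n , sym (p⊆q∧∣q∣≤∣p∣⇒p≡q Interval⊆U ∣U∣≤∣Interval∣)
  where
  filled : ∀ j → j ≤ k → toℕ a + j ∈ᴺ U
  filled zero    _     = a , a∈U , sym (+-identityʳ _)
  filled (suc j) 1+j≤k with filled j (<⇒≤ 1+j≤k)
  ... | w , w∈U , w≡a+j with any? (λ y → y ∈? U ×-dec toℕ w <? toℕ y)
  ...   | yes (y , y∈U , w<y) =
    subst (_∈ᴺ U) (trans (cong suc w≡a+j) (sym (+-suc _ j)))
      (DeletionsGapFree⇒1+x∈ᴺ (subst (2 <_) (sym ∣U∣≡1+k) (s≤s 2≤k)) gap-free w∈U y∈U w<y)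
  ...   | no nothing-above =
    contradiction (subst (_≤ k) ∣U∣≡1+k (≤-trans (∣p∣≤width (toℕ a) (suc j) U window) 1+j≤k)) 1+n≰n
    where
    window : ∀ {i} → i ∈ U → toℕ a ≤ toℕ i × toℕ i < toℕ a + suc j
    window {i} i∈U = a-least i∈U , subst (toℕ i <_) (sym (+-suc _ j))
      (s≤s (≤-trans (≮⇒≥ λ w<i → nothing-above (i , i∈U , w<i)) (≤-reflexive w≡a+j)))
  a+k<n : toℕ a + k < n
  a+k<n = let w , _ , w≡a+k = filled k ≤-refl in subst (_< n) w≡a+k (toℕ<n w)
  Interval⊆U : Interval n (toℕ a) k ⊆ U
  Interval⊆U {i} i∈I =
    let a≤i , i≤a+k = ∈-Interval⁻ {s = toℕ a} {k} i∈I
        i∸a≤k = subst (toℕ i ∸ toℕ a ≤_) (m+n∸m≡n (toℕ a) k) (∸-monoˡ-≤ (toℕ a) i≤a+k)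
        w , w∈U , w≡a+[i∸a] = filled (toℕ i ∸ toℕ a) i∸a≤k
    in  subst (_∈ U) (toℕ-injective (trans w≡a+[i∸a] (m+[n∸m]≡n a≤i))) w∈U
  ∣U∣≤∣Interval∣ : ∣ U ∣ ≤ ∣ Interval n (toℕ a) k ∣
  ∣U∣≤∣Interval∣ = subst (_≤ ∣ Interval n (toℕ a) k ∣) (sym ∣U∣≡1+k) (1+len≤∣Interval∣ a+k<n)

nonface⇔interval-complement : 2 ≤ k → ∣ ∁ σ ∣ ≡ suc k →
  (¬ IsFace (P² n) k σ) ⇔ (Σ ℕ λ s → (s + k < n) × (σ ≡ ∁ (Interval n s k)))
nonface⇔interval-complement {k = k} {n = n} {σ = σ} 2≤k ∣∁σ∣≡1+k = mk⇔ to from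
  where
  to : ¬ IsFace (P² n) k σ → Σ ℕ λ s → (s + k < n) × (σ ≡ ∁ (Interval n s k))
  to nonface =
    let s , s+k<n , ∁σ≡I = DeletionsGapFree⇒Interval 2≤k ∣∁σ∣≡1+k deletions-gap-free
    in  s , s+k<n , trans (sym (∁-involutive σ)) (cong ∁ ∁σ≡I)
    where
    deletions-gap-free : DeletionsGapFree (∁ σ)
    deletions-gap-free z∈∁σ z-gap = nonface (disconnected⇒face (p─q⊆p (∁ σ) _)
      (suc-injective (trans (sym (x∈p⇒∣p∣≡1+∣p-x∣ z∈∁σ)) ∣∁σ∣≡1+k)) (Gap⇒¬Connected z-gap))
  from : (Σ ℕ λ s → (s + k < n) × (σ ≡ ∁ (Interval n s k))) → ¬ IsFace (P² n) k σ
  from (s , _ , σ≡∁I) (T , ∣T∣≡k , disconnected , σ∩T≡∅) =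
    disconnected (¬Gap⇒Connected λ T-gap → <-irrefl ∣T∣≡k (Gap⊆Interval⇒∣T∣<len T-gap T⊆I))
    where
    T⊆I : T ⊆ Interval n s k
    T⊆I = subst (T ⊆_) (trans (cong ∁ σ≡∁I) (∁-involutive _)) (disjoint⇒⊆∁ σ∩T≡∅)

corollary4p2 : (n k : ℕ) → 2 ≤ k → k + 2 ≤ n →
    ((σ : Subset n) → ∣ σ ∣ ≤ n ∸ k ∸ 2 → IsFace (P² n) k σ)
    × ((σ : Subset n) → ∣ σ ∣ ≡ n ∸ k ∸ 1 →
        ((¬ IsFace (P² n) k σ) ⇔ (Σ ℕ λ s → (s + k < n) × (σ ≡ ∁ (Interval n s k)))))
    × ((σ : Subset n) → ∣ σ ∣ ≡ n ∸ k →
        ((¬ IsFace (P² n) k σ) ⇔ (Σ (Subset n) λ C → (∣ C ∣ ≡ k) × Connected (P² n) C × (σ ≡ ∁ C))))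
corollary4p2 n k 2≤k k+2≤n =
    (λ σ ∣σ∣≤n∸k∸2 → small⇒face 2≤k
       (∣p∣≤n∸m⇒m≤∣∁p∣ σ k+2≤n (subst (∣ σ ∣ ≤_) (∸-+-assoc n k 2) ∣σ∣≤n∸k∸2)))
  , (λ σ ∣σ∣≡n∸k∸1 → nonface⇔interval-complement 2≤k
       (∣p∣≡n∸m⇒∣∁p∣≡m σ 1+k≤n
         (trans ∣σ∣≡n∸k∸1 (trans (∸-+-assoc n k 1) (cong (n ∸_) (+-comm k 1))))))
  , (λ σ ∣σ∣≡n∸k → nonface⇔connected-complement Connected-P²-stable (∣p∣≡n∸m⇒∣∁p∣≡m σ k≤n ∣σ∣≡n∸k))
  where
  1+k≤n = ≤-trans (n≤1+n (suc k)) (subst (_≤ n) (+-comm k 2) k+2≤n)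
  k≤n = ≤-trans (m≤m+n k 2) k+2≤n
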